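{- Fix $k\in\mathbb{Z}_{>0}$ and let $n>4k$. Then every distance monoid $R$ with $n$ non-zero elements and Archimedean complexity $n-k$ contains an element $r$ such that $r<2r<\cdots<(n-k)r$.
   Context: A distance monoid is a structure $(R,\oplus,\leq,0)$ such that: $\leq$ is a total order on $R$; $r\leq r\oplus s$ for all $r,s$; if $r\leq t$ and $s\leq u$ then $r\oplus s\leq t\oplus u$; $\oplus$ is commutative and associative; and $r\oplus 0=r$ for all $r$. For $r\in R$, $mr$ denotes the $m$-fold sum $r\oplus\cdots\oplus r$. The Archimedean complexity $\mathrm{arch}(R)$ is the least $p$ such that for all $r_0\leq r_1\leq\cdots\leq r_p$ in $R$, $r_0\oplus r_1\oplus\cdots\oplus r_p=r_1\oplus\cdots\oplus r_p$. -}

module Defs where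

open import Level using (Level; _⊔_)
open import Data.Nat as ℕ using (ℕ)
open import Data.Fin using (Fin; _≤_)
open import Relation.Binary.PropositionalEquality using (_≡_)
open import Relation.Binary.Definitions using (Total)
open import Relation.Binary.Structures using (IsTotalOrder)
open import Relation.Nullary using (¬_)
open import Data.Product using (_×_)

record DistanceMonoid (c ℓ : Level) : Set (Level.suc (c ⊔ ℓ)) where
  infixl 6 _⊕_
  infix 4 _≼_
  field
    Carrier     : Set c
    _⊕_         : Carrier → Carrier → Carrier
    _≼_         : Carrier → Carrier → Set ℓ
    𝟘           : Carrier
    isTotalOrder : IsTotalOrder _≡_ _≼_
    ≼-⊕         : ∀ r s → r ≼ r ⊕ s
    ⊕-mono      : ∀ {r s t u} → r ≼ t → s ≼ u → r ⊕ s ≼ t ⊕ u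
    ⊕-comm      : ∀ r s → r ⊕ s ≡ s ⊕ r
    ⊕-assoc     : ∀ r s t → (r ⊕ s) ⊕ t ≡ r ⊕ (s ⊕ t)
    ⊕-identityʳ : ∀ r → r ⊕ 𝟘 ≡ r

  _≺_ : Carrier → Carrier → Set (c ⊔ ℓ)
  r ≺ s = (r ≼ s) × ¬ (r ≡ s)

  _·_ : ℕ → Carrier → Carrier
  ℕ.zero  · r = 𝟘
  ℕ.suc m · r = r ⊕ (m · r)

  ⨁ : ∀ {m} → (Fin m → Carrier) → Carrier
  ⨁ {ℕ.zero}  f = 𝟘
  ⨁ {ℕ.suc m} f = f Fin.zero ⊕ ⨁ (λ i → f (Fin.suc i))

  -- The defining property of "arch(R) ≤ p": for all r₀ ≼ r₁ ≼ … ≼ r_p,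
  -- r₀ ⊕ r₁ ⊕ … ⊕ r_p = r₁ ⊕ … ⊕ r_p.
  ArchProp : ℕ → Set (c ⊔ ℓ)
  ArchProp p = (r : Fin (ℕ.suc p) → Carrier)
             → (∀ i j → i ≤ j → r i ≼ r j)
             → ⨁ r ≡ ⨁ (λ i → r (Fin.suc i))

  HasArch : ℕ → Set (c ⊔ ℓ)
  HasArch p = ArchProp p × (∀ q → q ℕ.< p → ¬ ArchProp q)

  record NonZeroCount (n : ℕ) : Set c where
    field
      enum      : Fin n → Carrier
      injective : ∀ {i j} → enum i ≡ enum j → i ≡ j
      nonzero   : ∀ i → ¬ (enum i ≡ 𝟘)
      complete  : ∀ r → ¬ (r ≡ 𝟘) → Data.Product.Σ (Fin n) (λ i → enum i ≡ r)

{-# OPTIONS --safe #-}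

-- Let q = arch(R). If some r has (q − 1)·r ≠ q·r, then r ≺ 2r ≺ ⋯ ≺ q·r, because once
-- m·r = (m + 1)·r all later multiples coincide. Otherwise every a absorbs (q − 1)·a, and we show
-- arch(R) ≤ q − 1. Let r₀ ≼ ⋯ ≼ r_{q−1} be such that a = r₀ does not absorb s = r₁ ⊕ ⋯ ⊕ r_{q−1}.
-- Then s = g·a ⊕ P, where the b = q − 1 − g summands collected in P give b·a ≼ P, and the partial
-- sums of s carry a strictly increasing chain of q + b + 1 elements. The g + 1 multiples i·a
-- (i ≤ g) and the g + 2 elements j·a ⊕ P (j ≤ g + 1) are pairwise distinct, because a does not
-- absorb g·a ⊕ P but does absorb (g + b)·a. Counting against the n + 1 elements of R gives
-- 4q ≤ 3n, which is false when q = n − k and n > 4k.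

module Submission where

open import Defs
open import Level using (_⊔_)
open import Data.Nat using (ℕ; zero; suc; _+_; _*_; _∸_; _<_; _≤_; z≤n; s≤s; _<?_)
open import Data.Nat.Properties
  using ( ≤-refl; ≤-trans; ≤-pred; <⇒≤; <⇒≱; ≮⇒≥; m≤m+n; m≤n*m; +-suc; +-assoc; +-comm
        ; +-mono-≤; +-monoʳ-≤; +-monoʳ-<; +-cancelʳ-<; *-monoʳ-≤; *-distribˡ-+
        ; m∸n+n≡m; module ≤-Reasoning )
open import Data.Nat.Tactic.RingSolver using (solve-∀)
open import Data.Fin using (Fin)
open import Data.Fin.Properties using (injective⇒≤; ¬∀⟶∃¬)
open import Data.List using (List; []; _∷_; _++_; length; lookup; applyUpTo)
open import Data.List.Properties using (length-++; length-applyUpTo)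
open import Data.List.Relation.Binary.Disjoint.Propositional using (Disjoint)
open import Data.List.Membership.Propositional.Properties using (∈-lookup; ∈-applyUpTo⁻)
import Data.List.Relation.Unary.All as All
open import Data.List.Relation.Unary.AllPairs as AllPairs using (_∷_)
open import Data.List.Relation.Unary.Linked using (Linked; [-]; _∷_)
import Data.List.Relation.Unary.Linked.Properties as Linked
open import Data.List.Relation.Unary.Unique.Propositional using (Unique)
import Data.List.Relation.Unary.Unique.Propositional.Properties as Unique
open import Data.Product using (Σ; _,_; proj₁; proj₂)
open import Data.Sum using (inj₁; inj₂)
open import Function using (_∘_; flip)
open import Function.Definitions using (Injective)
open import Relation.Nullary using (¬_; yes; no; contradiction; contraposition)
open import Relation.Binary.Core using (Rel)
open import Relation.Binary.Definitions using (DecidableEquality; Transitive)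
open import Relation.Binary.Structures using (IsTotalOrder)
open import Relation.Binary.PropositionalEquality
  using (_≡_; _≢_; refl; sym; trans; cong; cong₂; subst; module ≡-Reasoning)
import Relation.Binary.Construct.NonStrictToStrict as NonStrictToStrict

Linked⇒Unique : ∀ {a r} {A : Set a} {_<_ : Rel A r} → Transitive _<_ → (∀ {x y} → x < y → x ≢ y)
              → ∀ {xs} → Linked _<_ xs → Unique xs
Linked⇒Unique <-trans <⇒≢ = AllPairs.map <⇒≢ ∘ Linked.Linked⇒AllPairs <-trans

Unique⇒lookup-injective : ∀ {a} {A : Set a} {xs : List A} → Unique xs → Injective _≡_ _≡_ (lookup xs)
Unique⇒lookup-injective (_ ∷ _) {Fin.zero} {Fin.zero} _ = refl
Unique⇒lookup-injective (x∉xs ∷ _) {Fin.zero} {Fin.suc j} x≡xⱼ =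
  contradiction x≡xⱼ (All.lookup x∉xs (∈-lookup j))
Unique⇒lookup-injective (x∉xs ∷ _) {Fin.suc i} {Fin.zero} xᵢ≡x =
  contradiction (sym xᵢ≡x) (All.lookup x∉xs (∈-lookup i))
Unique⇒lookup-injective (_ ∷ unique) {Fin.suc i} {Fin.suc j} xᵢ≡xⱼ =
  cong Fin.suc (Unique⇒lookup-injective unique xᵢ≡xⱼ)

3n<4[n∸k] : ∀ {k n} → 4 * k < n → 3 * n < 4 * (n ∸ k)
3n<4[n∸k] {k} {n} 4k<n = +-cancelʳ-< (4 * k) (3 * n) (4 * (n ∸ k)) (begin-strict
  3 * n + 4 * k        <⟨ +-monoʳ-< (3 * n) 4k<n ⟩
  3 * n + n            ≡⟨ +-comm (3 * n) n ⟩
  4 * n                ≡⟨ cong (4 *_) (sym (m∸n+n≡m k≤n)) ⟩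
  4 * (n ∸ k + k)      ≡⟨ *-distribˡ-+ 4 (n ∸ k) k ⟩
  4 * (n ∸ k) + 4 * k  ∎)
  where
  open ≤-Reasoning
  k≤n : k ≤ n
  k≤n = ≤-trans (m≤n*m k 4) (<⇒≤ 4k<n)

4[1+g+b]≤3n : ∀ {g b n} → g + suc (suc g) ≤ n → suc (g + b + b) ≤ n → 4 * suc (g + b) ≤ 3 * n
4[1+g+b]≤3n {g} {b} {n} orbits chain = begin
  4 * suc (g + b)                          ≡⟨ regroup g b ⟩
  (g + suc (suc g)) + 2 * suc (g + b + b)  ≤⟨ +-mono-≤ orbits (*-monoʳ-≤ 2 chain) ⟩
  3 * n                                    ∎
  where
  open ≤-Reasoning
  regroup : ∀ g b → 4 * suc (g + b) ≡ (g + suc (suc g)) + 2 * suc (g + b + b)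
  regroup = solve-∀

module DistanceMonoidProperties {c ℓ} (R : DistanceMonoid c ℓ) where
  open DistanceMonoid R
  open IsTotalOrder isTotalOrder using (total; antisym; isPartialOrder)
    renaming (refl to ≼-refl; trans to ≼-trans)
  open NonStrictToStrict _≡_ _≼_ using (<⇒≉; <-trans; <-≤-trans)

  infix 4 _≟_

  -- At x ≡ y both calls below are `total x x`, so they cannot disagree.
  _≟_ : DecidableEquality Carrier
  x ≟ y with total x y in xy | total y x in yx
  ... | inj₁ x≼y | inj₁ y≼x = yes (antisym x≼y y≼x)
  ... | inj₂ y≼x | inj₂ x≼y = yes (antisym x≼y y≼x)
  ... | inj₁ _   | inj₂ _   = no λ { refl → contradiction (trans (sym xy) yx) λ () }
  ... | inj₂ _   | inj₁ _   = no λ { refl → contradiction (trans (sym xy) yx) λ () }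

  ≺-trans : Transitive _≺_
  ≺-trans = <-trans isPartialOrder

  ≺-≼-trans : ∀ {x y z} → x ≺ y → y ≼ z → x ≺ z
  ≺-≼-trans = <-≤-trans sym ≼-trans antisym (subst (_ ≼_))

  ⊕-identityˡ : ∀ r → 𝟘 ⊕ r ≡ r
  ⊕-identityˡ r = trans (⊕-comm 𝟘 r) (⊕-identityʳ r)

  x⊕[y⊕z]≡y⊕[x⊕z] : ∀ x y z → x ⊕ (y ⊕ z) ≡ y ⊕ (x ⊕ z)
  x⊕[y⊕z]≡y⊕[x⊕z] x y z = begin
    x ⊕ (y ⊕ z)  ≡⟨ sym (⊕-assoc x y z) ⟩
    (x ⊕ y) ⊕ z  ≡⟨ cong (_⊕ z) (⊕-comm x y) ⟩
    (y ⊕ x) ⊕ z  ≡⟨ ⊕-assoc y x z ⟩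
    y ⊕ (x ⊕ z)  ∎
    where open ≡-Reasoning

  𝟘-least : ∀ r → 𝟘 ≼ r
  𝟘-least r = subst (𝟘 ≼_) (⊕-identityˡ r) (≼-⊕ 𝟘 r)

  ≼-⊕ˡ : ∀ r s → r ≼ s ⊕ r
  ≼-⊕ˡ r s = subst (r ≼_) (⊕-comm r s) (≼-⊕ r s)

  ·-homo-+ : ∀ m n r → (m + n) · r ≡ m · r ⊕ n · r
  ·-homo-+ zero    n r = sym (⊕-identityˡ (n · r))
  ·-homo-+ (suc m) n r = trans (cong (r ⊕_) (·-homo-+ m n r)) (sym (⊕-assoc r (m · r) (n · r)))

  ·-monoˡ-≼ : ∀ r {m n} → m ≤ n → m · r ≼ n · r
  ·-monoˡ-≼ r {zero}  {n}     _          = 𝟘-least (n · r)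
  ·-monoˡ-≼ r {suc m} {suc n} (s≤s m≤n) = ⊕-mono ≼-refl (·-monoˡ-≼ r m≤n)

  ·-zeroʳ : ∀ m → m · 𝟘 ≡ 𝟘
  ·-zeroʳ zero    = refl
  ·-zeroʳ (suc m) = trans (⊕-identityˡ (m · 𝟘)) (·-zeroʳ m)

  ·-⊕-split : ∀ a x {j m} → j ≤ m → m · a ⊕ x ≡ (m ∸ j) · a ⊕ (j · a ⊕ x)
  ·-⊕-split a x {j} {m} j≤m = begin
    m · a ⊕ x                      ≡⟨ cong (λ k → k · a ⊕ x) (sym (m∸n+n≡m j≤m)) ⟩
    (m ∸ j + j) · a ⊕ x            ≡⟨ cong (_⊕ x) (·-homo-+ (m ∸ j) j a) ⟩
    ((m ∸ j) · a ⊕ j · a) ⊕ x      ≡⟨ ⊕-assoc ((m ∸ j) · a) (j · a) x ⟩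
    (m ∸ j) · a ⊕ (j · a ⊕ x)      ∎
    where open ≡-Reasoning

  Stable : ℕ → Carrier → Set c
  Stable m r = m · r ≡ suc m · r

  stable-+ : ∀ d {m r} → Stable m r → Stable (d + m) r
  stable-+ zero    stable = stable
  stable-+ (suc d) {r = r} stable = cong (r ⊕_) (stable-+ d stable)

  stable-mono : ∀ {m n r} → m ≤ n → Stable m r → Stable n r
  stable-mono {m} {n} {r} m≤n stable =
    subst (λ k → Stable k r) (m∸n+n≡m m≤n) (stable-+ (n ∸ m) stable)

  ¬stable⇒·-increasing : ∀ {p r} → ¬ Stable p r → ∀ {i} → i ≤ p → (i · r) ≺ (suc i · r)
  ¬stable⇒·-increasing {r = r} ¬stable {i} i≤p =
    ≼-⊕ˡ (i · r) r , contraposition (stable-mono i≤p) ¬stable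

  _absorbs_ : Carrier → Carrier → Set c
  a absorbs x = a ⊕ x ≡ x

  absorbs-⊕ˡ : ∀ {a x} y → a absorbs x → a absorbs (y ⊕ x)
  absorbs-⊕ˡ {a} {x} y a⊕x≡x = trans (x⊕[y⊕z]≡y⊕[x⊕z] a y x) (cong (y ⊕_) a⊕x≡x)

  ¬absorbs⇒≺ : ∀ {a x} → ¬ a absorbs x → x ≺ (a ⊕ x)
  ¬absorbs⇒≺ {a} {x} ¬absorbs = ≼-⊕ˡ x a , ¬absorbs ∘ sym

  increasing⇒Unique : ∀ (F : ℕ → Carrier) m → (∀ {i} → suc i < m → F i ≺ F (suc i))
                    → Unique (applyUpTo F m)
  increasing⇒Unique F m increasing = Linked⇒Unique ≺-trans <⇒≉ (Linked.applyUpTo⁺₁ F m increasing)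

  descending⇒Unique : ∀ {xs} → Linked (flip _≺_) xs → Unique xs
  descending⇒Unique = Linked⇒Unique (flip ≺-trans) (λ y≺x → <⇒≉ y≺x ∘ sym)

  module _ (a : Carrier) where

    -- The summands y are added to the partial sum s one at a time. If y ⊕ s ≡ a ⊕ s, then y may
    -- be replaced by a (counted by g); otherwise y goes into P (counted by b) and adds the extra
    -- link s ≺ a ⊕ s ≺ y ⊕ s to the chain.
    record Decomposition (m : ℕ) (s : Carrier) : Set (c ⊔ ℓ) where
      field
        g b              : ℕ
        P                : Carrier
        g+b≡m            : g + b ≡ m
        s≡g·a⊕P          : s ≡ g · a ⊕ P
        b·a≼P            : b · a ≼ P
        chain            : List Carrier
        chain-descending : Linked (flip _≺_) (a ⊕ s ∷ chain)
        length-chain     : length chain ≡ suc (m + b)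

    extend-absorbed : ∀ {m s y} → Decomposition m s → y ⊕ s ≡ a ⊕ s → ¬ a absorbs (y ⊕ s)
                    → Decomposition (suc m) (y ⊕ s)
    extend-absorbed {s = s} {y} D y⊕s≡a⊕s ¬absorbs = record
      { g                = suc g
      ; b                = b
      ; P                = P
      ; g+b≡m            = cong suc g+b≡m
      ; s≡g·a⊕P          = begin
          y ⊕ s              ≡⟨ y⊕s≡a⊕s ⟩
          a ⊕ s              ≡⟨ cong (a ⊕_) s≡g·a⊕P ⟩
          a ⊕ (g · a ⊕ P)    ≡⟨ sym (⊕-assoc a (g · a) P) ⟩
          (a ⊕ g · a) ⊕ P    ∎
      ; b·a≼P            = b·a≼P
      ; chain            = a ⊕ s ∷ chain
      ; chain-descending = subst (_≺ (a ⊕ (y ⊕ s))) y⊕s≡a⊕s (¬absorbs⇒≺ ¬absorbs) ∷ chain-descending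
      ; length-chain     = cong suc length-chain
      }
      where
      open Decomposition D
      open ≡-Reasoning

    extend-fresh : ∀ {m s y} → Decomposition m s → a ≼ y → y ⊕ s ≢ a ⊕ s → ¬ a absorbs (y ⊕ s)
                 → Decomposition (suc m) (y ⊕ s)
    extend-fresh {m} {s} {y} D a≼y y⊕s≢a⊕s ¬absorbs = record
      { g                = g
      ; b                = suc b
      ; P                = y ⊕ P
      ; g+b≡m            = trans (+-suc g b) (cong suc g+b≡m)
      ; s≡g·a⊕P          = trans (cong (y ⊕_) s≡g·a⊕P) (x⊕[y⊕z]≡y⊕[x⊕z] y (g · a) P)
      ; b·a≼P            = ⊕-mono a≼y b·a≼P
      ; chain            = y ⊕ s ∷ a ⊕ s ∷ chain
      ; chain-descending = ¬absorbs⇒≺ ¬absorbs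
                         ∷ (⊕-mono a≼y ≼-refl , y⊕s≢a⊕s ∘ sym)
                         ∷ chain-descending
      ; length-chain     = cong (suc ∘ suc) (trans length-chain (sym (+-suc m b)))
      }
      where open Decomposition D

    extend : ∀ {m s y} → Decomposition m s → a ≼ y → ¬ a absorbs (y ⊕ s)
           → Decomposition (suc m) (y ⊕ s)
    extend {s = s} {y} D a≼y ¬absorbs with y ⊕ s ≟ a ⊕ s
    ... | yes y⊕s≡a⊕s = extend-absorbed D y⊕s≡a⊕s ¬absorbs
    ... | no  y⊕s≢a⊕s = extend-fresh D a≼y y⊕s≢a⊕s ¬absorbs

    decompose : ∀ {m} (f : Fin m → Carrier) → (∀ i → a ≼ f i) → ¬ a absorbs ⨁ f
              → Decomposition m (⨁ f)
    decompose {zero} f _ ¬absorbs = record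
      { g = 0 ; b = 0 ; P = 𝟘
      ; g+b≡m = refl ; s≡g·a⊕P = sym (⊕-identityʳ 𝟘) ; b·a≼P = ≼-refl
      ; chain = 𝟘 ∷ [] ; chain-descending = ¬absorbs⇒≺ ¬absorbs ∷ [-] ; length-chain = refl
      }
    decompose {suc m} f a≼f ¬absorbs = extend
      (decompose (f ∘ Fin.suc) (a≼f ∘ Fin.suc) (contraposition (absorbs-⊕ˡ (f Fin.zero)) ¬absorbs))
      (a≼f Fin.zero) ¬absorbs

    module Orbits (g b : ℕ) {P : Carrier} (b·a≼P : b · a ≼ P) (stable : Stable (g + b) a)
                  (¬absorbs : ¬ a absorbs (g · a ⊕ P)) where

      multiples : List Carrier
      multiples = applyUpTo (_· a) (suc g)

      shifted : List Carrier
      shifted = applyUpTo (λ j → j · a ⊕ P) (suc (suc g))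

      ¬stable : ¬ Stable g a
      ¬stable = ¬absorbs ∘ subst (a absorbs_) (⊕-comm P (g · a)) ∘ absorbs-⊕ˡ P ∘ sym

      ¬absorbs-shifted : ∀ {j} → j ≤ g → ¬ a absorbs (j · a ⊕ P)
      ¬absorbs-shifted {j} j≤g =
        ¬absorbs ∘ subst (a absorbs_) (sym (·-⊕-split a P j≤g)) ∘ absorbs-⊕ˡ ((g ∸ j) · a)

      [j+b]·a≼j·a⊕P : ∀ j → (j + b) · a ≼ j · a ⊕ P
      [j+b]·a≼j·a⊕P j = subst (_≼ j · a ⊕ P) (sym (·-homo-+ j b a)) (⊕-mono ≼-refl b·a≼P)

      multiple≢shifted : ∀ {i j} → i ≤ g → i · a ≢ j · a ⊕ P
      multiple≢shifted {i} {j} i≤g with i <? j + b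
      ... | yes i<j+b = <⇒≉ (≺-≼-trans (¬stable⇒·-increasing ¬stable i≤g)
                                       (≼-trans (·-monoˡ-≼ a i<j+b) ([j+b]·a≼j·a⊕P j)))
      ... | no  i≮j+b = λ i·a≡j·a⊕P →
              ¬absorbs (subst (a absorbs_) (sym (g·a⊕P≡[g∸j+i]·a i·a≡j·a⊕P))
                              (sym (stable-mono g+b≤g∸j+i stable)))
        where
        j+b≤i : j + b ≤ i
        j+b≤i = ≮⇒≥ i≮j+b
        j≤g : j ≤ g
        j≤g = ≤-trans (m≤m+n j b) (≤-trans j+b≤i i≤g)
        g+b≤g∸j+i : g + b ≤ g ∸ j + i
        g+b≤g∸j+i = begin
          g + b            ≡⟨ cong (_+ b) (sym (m∸n+n≡m j≤g)) ⟩
          g ∸ j + j + b    ≡⟨ +-assoc (g ∸ j) j b ⟩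
          g ∸ j + (j + b)  ≤⟨ +-monoʳ-≤ (g ∸ j) j+b≤i ⟩
          g ∸ j + i        ∎
          where open ≤-Reasoning
        g·a⊕P≡[g∸j+i]·a : i · a ≡ j · a ⊕ P → g · a ⊕ P ≡ (g ∸ j + i) · a
        g·a⊕P≡[g∸j+i]·a i·a≡j·a⊕P = begin
          g · a ⊕ P                  ≡⟨ ·-⊕-split a P j≤g ⟩
          (g ∸ j) · a ⊕ (j · a ⊕ P)  ≡⟨ cong ((g ∸ j) · a ⊕_) (sym i·a≡j·a⊕P) ⟩
          (g ∸ j) · a ⊕ i · a        ≡⟨ sym (·-homo-+ (g ∸ j) i a) ⟩
          (g ∸ j + i) · a            ∎
          where open ≡-Reasoning

      multiples-unique : Unique multiples
      multiples-unique = increasing⇒Unique (_· a) (suc g)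
        (λ 2+i≤1+g → ¬stable⇒·-increasing ¬stable (<⇒≤ (≤-pred 2+i≤1+g)))

      shifted-unique : Unique shifted
      shifted-unique = increasing⇒Unique (λ j → j · a ⊕ P) (suc (suc g)) λ {j} 2+j≤2+g →
        subst ((j · a ⊕ P) ≺_) (sym (⊕-assoc a (j · a) P))
              (¬absorbs⇒≺ (¬absorbs-shifted (≤-pred (≤-pred 2+j≤2+g))))

      multiples-shifted-disjoint : Disjoint multiples shifted
      multiples-shifted-disjoint (v∈multiples , v∈shifted)
        with ∈-applyUpTo⁻ (_· a) v∈multiples | ∈-applyUpTo⁻ (λ j → j · a ⊕ P) v∈shifted
      ... | _ , i<1+g , refl | j , _ , i·a≡j·a⊕P = multiple≢shifted {j = j} (≤-pred i<1+g) i·a≡j·a⊕P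

      orbits-unique : Unique (multiples ++ shifted)
      orbits-unique = Unique.++⁺ multiples-unique shifted-unique multiples-shifted-disjoint

      length-orbits : length (multiples ++ shifted) ≡ suc g + suc (suc g)
      length-orbits = trans (length-++ multiples) (cong₂ _+_
        (length-applyUpTo (_· a) (suc g))
        (length-applyUpTo (λ j → j · a ⊕ P) (suc (suc g))))

  module _ {n : ℕ} (nz : NonZeroCount n) where
    open NonZeroCount nz

    element : Fin (suc n) → Carrier
    element Fin.zero    = 𝟘
    element (Fin.suc i) = enum i

    index : Carrier → Fin (suc n)
    index r with r ≟ 𝟘
    ... | yes _   = Fin.zero
    ... | no  r≢𝟘 = Fin.suc (proj₁ (complete r r≢𝟘))

    element∘index : ∀ r → element (index r) ≡ r
    element∘index r with r ≟ 𝟘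
    ... | yes r≡𝟘 = sym r≡𝟘
    ... | no  r≢𝟘 = proj₂ (complete r r≢𝟘)

    Unique⇒length≤ : ∀ {xs} → Unique xs → length xs ≤ suc n
    Unique⇒length≤ {xs} unique = injective⇒≤ {f = index ∘ lookup xs} λ {i} {j} index-eq →
      Unique⇒lookup-injective unique (begin
        lookup xs i                    ≡⟨ sym (element∘index (lookup xs i)) ⟩
        element (index (lookup xs i))  ≡⟨ cong element index-eq ⟩
        element (index (lookup xs j))  ≡⟨ element∘index (lookup xs j) ⟩
        lookup xs j                    ∎)
      where open ≡-Reasoning

    stable-enum⇒stable : ∀ {p} → (∀ i → Stable p (enum i)) → ∀ r → Stable p r
    stable-enum⇒stable {p} stable r with r ≟ 𝟘
    ... | yes refl = trans (·-zeroʳ p) (sym (·-zeroʳ (suc p)))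
    ... | no  r≢𝟘 with complete r r≢𝟘
    ... | i , refl = stable i

    stable⇒archProp : ∀ {p} → 3 * n < 4 * suc p → (∀ r → Stable p r) → ArchProp p
    stable⇒archProp {p} 3n<4[1+p] stable r sorted with ⨁ r ≟ ⨁ (r ∘ Fin.suc)
    ... | yes a⊕s≡s   = a⊕s≡s
    ... | no  ¬absorbs = contradiction
          (subst (λ m → 4 * suc m ≤ 3 * n) g+b≡m (4[1+g+b]≤3n orbits-bound chain-bound))
          (<⇒≱ 3n<4[1+p])
      where
      a : Carrier
      a = r Fin.zero
      open Decomposition (decompose a (r ∘ Fin.suc) (λ i → sorted Fin.zero (Fin.suc i) z≤n) ¬absorbs)
      open Orbits a g b b·a≼P (subst (λ m → Stable m a) (sym g+b≡m) (stable a))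
                  (¬absorbs ∘ subst (a absorbs_) (sym s≡g·a⊕P))
      chain-bound : suc (g + b + b) ≤ n
      chain-bound = ≤-pred (subst (_≤ suc n)
        (cong suc (trans length-chain (cong (λ m → suc (m + b)) (sym g+b≡m))))
        (Unique⇒length≤ (descending⇒Unique chain-descending)))
      orbits-bound : g + suc (suc g) ≤ n
      orbits-bound = ≤-pred (subst (_≤ suc n) length-orbits (Unique⇒length≤ orbits-unique))

    multiples-strictly-increasing : ∀ {q} → 3 * n < 4 * q → HasArch q
                                  → Σ Carrier λ r → ∀ i → i < q → (i · r) ≺ (suc i · r)
    multiples-strictly-increasing {zero} () _
    multiples-strictly-increasing {suc p} 3n<4q (_ , minimal)
      with ¬∀⟶∃¬ n (λ i → Stable p (enum i)) (λ i → p · enum i ≟ suc p · enum i)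
                 (minimal p ≤-refl ∘ stable⇒archProp 3n<4q ∘ stable-enum⇒stable {p})
    ... | i , ¬stable = enum i , λ j j<1+p → ¬stable⇒·-increasing ¬stable (≤-pred j<1+p)

open DistanceMonoidProperties using (multiples-strictly-increasing)

theorem4p3 : ∀ {c ℓ} (k n : ℕ) → 1 ≤ k → 4 * k < n
    → (R : DistanceMonoid c ℓ)
    → DistanceMonoid.NonZeroCount R n
    → DistanceMonoid.HasArch R (n ∸ k)
    → Σ (DistanceMonoid.Carrier R) (λ r →
        ∀ i → 1 ≤ i → i < n ∸ k
          → DistanceMonoid._≺_ R (DistanceMonoid._·_ R i r) (DistanceMonoid._·_ R (suc i) r))
theorem4p3 k n _ 4k<n R nz arch with multiples-strictly-increasing R nz (3n<4[n∸k] {k} 4k<n) arch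
... | r , increasing = r , λ i _ → increasing i
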